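{- Let $x$ and $y$ be pyramidal tours with step-backs on the city set $\{1,\dots,n\}$. If the vertices $x^v$ and $y^v$ of the polytope $\mathrm{PSB}(n)$ are not adjacent, then there exist at least two pyramidal tours with step-backs, different from $x$ and $y$, all of whose edges are edges of the multigraph $x\cup y$.
   Context: Let $D_n=(V,E)$ be the complete directed graph on the cities $V=\{1,\dots,n\}$. For a Hamiltonian directed cycle (tour) $\tau$ write $\tau(i)$ for the successor of $i$, $\tau^k(i)$ for the $k$-th successor and $\tau^{ -k}(i)$ for the $k$-th predecessor. A city $i$ is a peak if $\tau^{ -1}(i)<i$ and $\tau(i)<i$. A city $i$ is a step-back peak if either ($\tau^{ -1}(i)<i$, $\tau(i)=i-1$ and $\tau^2(i)>i$) or ($\tau^{ -2}(i)>i$, $\tau^{ -1}(i)=i-1$ and $\tau(i)<i$). A proper peak is a peak that is not a step-back peak. A pyramidal tour with step-backs is a Hamiltonian tour whose only proper peak is $n$. The characteristic vector $x^v\in\mathbb{R}^E$ of a tour $x$ has $x^v_e=1$ if $e$ is in $x$ and $0$ otherwise. $\mathrm{PSB}(n)$ is the convex hull of the characteristic vectors of all pyramidal tours with step-backs in $D_n$; two vertices are adjacent if the segment joining them is an edge (one-dimensional face) of $\mathrm{PSB}(n)$. $x\cup y$ denotes the multigraph containing all edges of both tours. -}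

module Defs where

open import Data.Nat as ℕ using (ℕ; zero; suc)
open import Data.Fin using (Fin; toℕ)
open import Data.Fin.Base using () renaming (_<_ to _<ᶠ_)
open import Data.List using (List; foldr; map)
open import Data.List.Base using ()
open import Data.Fin.Base using ()
open import Data.Rational as ℚ using (ℚ; 0ℚ)
open import Data.Product using (Σ; ∃; _×_; _,_)
open import Data.Sum using (_⊎_)
open import Relation.Binary.PropositionalEquality using (_≡_)
open import Relation.Nullary using (¬_)
import Data.List as L
import Data.Fin as F

-- Cities 1..n are represented by Fin n (city c ↔ toℕ c + 1); the order on
-- cities is the order of toℕ.  A tour is given by its successor function τ.

iter : ∀ {n} → (Fin n → Fin n) → ℕ → Fin n → Fin n
iter τ zero    i = i
iter τ (suc k) i = τ (iter τ k i)

IsTour : ∀ {n} → (Fin n → Fin n) → Set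
IsTour {n} τ = (∀ i → ¬ τ i ≡ i) × (∀ i j → ∃ λ k → iter τ k i ≡ j)

_≺_ : ∀ {n} → Fin n → Fin n → Set
i ≺ j = toℕ i ℕ.< toℕ j

IsPrev : ∀ {n} → Fin n → Fin n → Set
IsPrev j i = suc (toℕ j) ≡ toℕ i

Peak : ∀ {n} → (Fin n → Fin n) → Fin n → Set
Peak τ i = (∃ λ p → τ p ≡ i × p ≺ i) × τ i ≺ i

StepBackPeak : ∀ {n} → (Fin n → Fin n) → Fin n → Set
StepBackPeak τ i =
    ((∃ λ p → τ p ≡ i × p ≺ i) × IsPrev (τ i) i × i ≺ τ (τ i))
  ⊎ ((∃ λ p → ∃ λ q → τ p ≡ i × τ q ≡ p × i ≺ q × IsPrev p i) × τ i ≺ i)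

ProperPeak : ∀ {n} → (Fin n → Fin n) → Fin n → Set
ProperPeak τ i = Peak τ i × ¬ StepBackPeak τ i

-- pyramidal tour with step-backs: a tour whose only proper peak is city n
-- (i.e. the element of Fin n with toℕ i = n - 1)
IsPSB : ∀ {n} → (Fin n → Fin n) → Set
IsPSB {n} τ = IsTour τ × (∀ i → ProperPeak τ i → suc (toℕ i) ≡ n)

SameTour : ∀ {n} → (Fin n → Fin n) → (Fin n → Fin n) → Set
SameTour τ σ = ∀ i → τ i ≡ σ i

-- linear functional c on ℚ^E evaluated at the characteristic vector of τ:
-- Σ_{(i,j) ∈ E} c(i,j) x^v_(i,j) = Σ_i c(i, τ i)
value : ∀ {n} → (Fin n → Fin n → ℚ) → (Fin n → Fin n) → ℚ
value {n} c τ = foldr ℚ._+_ 0ℚ (map (λ i → c i (τ i)) (L.allFin n))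

-- x^v and y^v are adjacent vertices of PSB(n): they are distinct and the
-- segment [x^v, y^v] is a face of PSB(n), i.e. there is a linear functional
-- maximised over the vertices of PSB(n) exactly at x^v and y^v.
Adjacent : ∀ {n} → (Fin n → Fin n) → (Fin n → Fin n) → Set
Adjacent {n} x y =
  ¬ SameTour x y ×
  ∃ λ (c : Fin n → Fin n → ℚ) →
    value c x ≡ value c y ×
    (∀ z → IsPSB z → ¬ SameTour z x → ¬ SameTour z y → value c z ℚ.< value c x)

EdgesIn : ∀ {n} → (Fin n → Fin n) → (Fin n → Fin n) → (Fin n → Fin n) → Set
EdgesIn σ x y = ∀ i → σ i ≡ x i ⊎ σ i ≡ y i

{-# OPTIONS --safe #-}
-- If x ∪ y contains no two further pyramidal tours with step-backs, a cost
-- function exposes the segment [xᵛ, yᵛ] as an edge of PSB(n).  Charge 2 for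
-- every arc outside x ∪ y and 1 for each of two marked arcs (a, y a) and
-- (b, x b): when x ∪ y contains exactly one further tour z₁, take a and b
-- where z₁ leaves x and y respectively; when it contains none, take a = b
-- any city where x and y differ.  Then x and y both cost 1 and every other
-- tour costs at least 2, so the negated cost is maximised exactly at x and y.
-- The case distinction is constructive because the tours inside x ∪ y are
-- enumerated by subsets of cities, and being a pyramidal tour with
-- step-backs is decidable.
module Submission where

open import Defs
open import Data.Nat using (ℕ)
open import Data.Fin using (Fin; zero; suc; toℕ; fromℕ<)
open import Data.Product using (∃; ∃₂; _×_; _,_; proj₂)
open import Relation.Nullary using (¬_)

import Algebra.Properties.CommutativeMonoid.Sum as Sum
open import Data.Bool using (true; false; if_then_else_)
open import Data.Empty using (⊥-elim)
open import Data.Fin.Properties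
  using (_≟_; all?; any?; ¬∀⟶∃¬; pigeonhole; toℕ<n; toℕ-fromℕ<; suc-injective; 0≢1+n)
open import Data.Fin.Subset using (Subset)
open import Data.Fin.Subset.Properties using (anySubset?)
open import Data.List as List using (foldr)
open import Data.List.Properties using (map-tabulate)
open import Data.Nat as ℕ using (_+_; _∸_; _≤_; _<_; _<?_)
open import Data.Nat.Induction using (<-rec)
open import Data.Nat.Properties
  using (n<1+n; ≤-pred; ≤-trans; ≮⇒≥; m∸n+n≡m; +-monoʳ-<)
open import Data.Rational as ℚ using (ℚ; 0ℚ; 1ℚ; -_)
import Data.Rational.Properties as ℚ
open import Data.Sum using (_⊎_; inj₁; inj₂; swap)
open import Data.Vec using (lookup; tabulate)
open import Data.Vec.Properties using (lookup∘tabulate)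
open import Function using (id; _∘_)
open import Relation.Binary.PropositionalEquality
open import Relation.Nullary using (Dec; yes; no; does; ¬?)
open import Relation.Nullary.Decidable
  using (_×-dec_; _⊎-dec_; _→-dec_; map′; toWitness; decidable-stable)
open import Relation.Unary using (Decidable)

open Sum ℚ.+-0-commutativeMonoid using (sum; ∑-distrib-+)

private variable
  n : ℕ
  A : Set
  τ σ : Fin n → Fin n

𝟙 : Dec A → ℚ
𝟙 (yes _) = 1ℚ
𝟙 (no _)  = 0ℚ

𝟙-nonneg : (A? : Dec A) → 0ℚ ℚ.≤ 𝟙 A?
𝟙-nonneg (yes _) = ℚ.nonNegative⁻¹ 1ℚ
𝟙-nonneg (no _)  = ℚ.≤-refl

count : {Q : Fin n → Set} → Decidable Q → ℚ
count Q? = sum (λ i → 𝟙 (Q? i))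

count-nonneg : ∀ {n} {Q : Fin n → Set} (Q? : Decidable Q) → 0ℚ ℚ.≤ count Q?
count-nonneg {n = ℕ.zero}  Q? = ℚ.≤-refl
count-nonneg {n = ℕ.suc n} Q? = ℚ.+-mono-≤ (𝟙-nonneg (Q? zero)) (count-nonneg (Q? ∘ suc))

count-≡0 : ∀ {n} {Q : Fin n → Set} (Q? : Decidable Q) → (∀ i → ¬ Q i) → count Q? ≡ 0ℚ
count-≡0 {n = ℕ.zero}  Q? none = refl
count-≡0 {n = ℕ.suc n} Q? none with Q? zero
... | yes q = ⊥-elim (none zero q)
... | no _  = cong (0ℚ ℚ.+_) (count-≡0 (Q? ∘ suc) (none ∘ suc))

count-≡1 : ∀ {n} {Q : Fin n → Set} (Q? : Decidable Q) {a : Fin n} → Q a → (∀ i → Q i → i ≡ a) →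
           count Q? ≡ 1ℚ
count-≡1 Q? {zero} q₀ only with Q? zero
... | yes _ = cong (1ℚ ℚ.+_) (count-≡0 (Q? ∘ suc) (λ i q → 0≢1+n (sym (only (suc i) q))))
... | no ¬q₀ = ⊥-elim (¬q₀ q₀)
count-≡1 Q? {suc a} qa only with Q? zero
... | yes q₀ with () ← only zero q₀
... | no _   = cong (0ℚ ℚ.+_) (count-≡1 (Q? ∘ suc) qa (λ i q → suc-injective (only (suc i) q)))

count-≥1 : ∀ {n} {Q : Fin n → Set} (Q? : Decidable Q) {a : Fin n} → Q a → 1ℚ ℚ.≤ count Q?
count-≥1 Q? {zero} q₀ with Q? zero
... | yes _  = ℚ.+-mono-≤ (ℚ.≤-refl {1ℚ}) (count-nonneg (Q? ∘ suc))
... | no ¬q₀ = ⊥-elim (¬q₀ q₀)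
count-≥1 Q? {suc a} qa = ℚ.+-mono-≤ (𝟙-nonneg (Q? zero)) (count-≥1 (Q? ∘ suc) qa)

sum-neg : (f : Fin n → ℚ) → sum (λ i → - f i) ≡ - sum f
sum-neg {n = ℕ.zero}  f = refl
sum-neg {n = ℕ.suc n} f = begin
  - f zero ℚ.+ sum (λ i → - f (suc i)) ≡⟨ cong (- f zero ℚ.+_) (sum-neg (f ∘ suc)) ⟩
  - f zero ℚ.+ - sum (f ∘ suc)         ≡⟨ ℚ.neg-distrib-+ (f zero) (sum (f ∘ suc)) ⟨
  - (f zero ℚ.+ sum (f ∘ suc))         ∎
  where open ≡-Reasoning

foldr-tabulate : (f : Fin n → ℚ) → foldr ℚ._+_ 0ℚ (List.tabulate f) ≡ sum f
foldr-tabulate {n = ℕ.zero}  f = refl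
foldr-tabulate {n = ℕ.suc n} f = cong (f zero ℚ.+_) (foldr-tabulate (f ∘ suc))

value≡sum : (c : Fin n → Fin n → ℚ) (τ : Fin n → Fin n) → value c τ ≡ sum (λ i → c i (τ i))
value≡sum c τ =
  trans (cong (foldr ℚ._+_ 0ℚ) (map-tabulate id λ i → c i (τ i))) (foldr-tabulate λ i → c i (τ i))

value-neg : (c : Fin n → Fin n → ℚ) (τ : Fin n → Fin n) → value (λ i j → - c i j) τ ≡ - value c τ
value-neg c τ = begin
  value (λ i j → - c i j) τ ≡⟨ value≡sum (λ i j → - c i j) τ ⟩
  sum (λ i → - c i (τ i))   ≡⟨ sum-neg (λ i → c i (τ i)) ⟩
  - sum (λ i → c i (τ i))   ≡⟨ cong -_ (value≡sum c τ) ⟨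
  - value c τ               ∎
  where open ≡-Reasoning

iter-+ : (τ : Fin n → Fin n) (k l : ℕ) (i : Fin n) → iter τ (k + l) i ≡ iter τ k (iter τ l i)
iter-+ τ ℕ.zero    l i = refl
iter-+ τ (ℕ.suc k) l i = cong τ (iter-+ τ k l i)

iter-shortcut : ∀ (τ : Fin n → Fin n) i {k s t} → iter τ s i ≡ iter τ t i → t ≤ k →
                iter τ (k ∸ t + s) i ≡ iter τ k i
iter-shortcut τ i {k} {s} {t} same t≤k = begin
  iter τ (k ∸ t + s) i        ≡⟨ iter-+ τ (k ∸ t) s i ⟩
  iter τ (k ∸ t) (iter τ s i) ≡⟨ cong (iter τ (k ∸ t)) same ⟩
  iter τ (k ∸ t) (iter τ t i) ≡⟨ iter-+ τ (k ∸ t) t i ⟨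
  iter τ (k ∸ t + t) i        ≡⟨ cong (λ m → iter τ m i) (m∸n+n≡m t≤k) ⟩
  iter τ k i                  ∎
  where open ≡-Reasoning

-- A walk of length k ≥ n repeats a city among its first n + 1 (pigeonhole),
-- so it can be shortened; hence reachability needs fewer than n steps.
iter-within : (τ : Fin n → Fin n) (i j : Fin n) (k : ℕ) → iter τ k i ≡ j →
              ∃ λ (k′ : Fin n) → iter τ (toℕ k′) i ≡ j
iter-within {n} τ i j = <-rec _ shorten
  where
  Within : Set
  Within = ∃ λ (k′ : Fin n) → iter τ (toℕ k′) i ≡ j

  shorten : ∀ k → (∀ {m} → m < k → iter τ m i ≡ j → Within) → iter τ k i ≡ j → Within
  shorten k shorter reach with k <? n
  ... | yes k<n = fromℕ< k<n , trans (cong (λ m → iter τ m i) (toℕ-fromℕ< k<n)) reach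
  ... | no k≮n with pigeonhole (n<1+n n) (λ t → iter τ (toℕ t) i)
  ...   | s , t , s<t , same = shorter k∸t+s<k (trans (iter-shortcut τ i same t≤k) reach)
    where
    t≤k : toℕ t ≤ k
    t≤k = ≤-trans (≤-pred (toℕ<n t)) (≮⇒≥ k≮n)
    k∸t+s<k : k ∸ toℕ t + toℕ s < k
    k∸t+s<k = subst (k ∸ toℕ t + toℕ s <_) (m∸n+n≡m t≤k) (+-monoʳ-< (k ∸ toℕ t) s<t)

isTour? : (τ : Fin n → Fin n) → Dec (IsTour τ)
isTour? τ = all? (λ i → ¬? (τ i ≟ i)) ×-dec all? λ i → all? λ j →
  map′ (λ (k , reach) → toℕ k , reach) (λ (k , reach) → iter-within τ i j k reach)
       (any? λ k → iter τ (toℕ k) i ≟ j)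

_≺?_ : (i j : Fin n) → Dec (i ≺ j)
i ≺? j = toℕ i <? toℕ j

isPrev? : (j i : Fin n) → Dec (IsPrev j i)
isPrev? j i = ℕ.suc (toℕ j) ℕ.≟ toℕ i

enteredFromBelow? : (τ : Fin n → Fin n) (i : Fin n) → Dec (∃ λ p → τ p ≡ i × p ≺ i)
enteredFromBelow? τ i = any? λ p → (τ p ≟ i) ×-dec (p ≺? i)

peak? : (τ : Fin n → Fin n) (i : Fin n) → Dec (Peak τ i)
peak? τ i = enteredFromBelow? τ i ×-dec (τ i ≺? i)

stepBackPeak? : (τ : Fin n → Fin n) (i : Fin n) → Dec (StepBackPeak τ i)
stepBackPeak? τ i =
  (enteredFromBelow? τ i ×-dec isPrev? (τ i) i ×-dec (i ≺? τ (τ i)))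
  ⊎-dec
  ((any? λ p → any? λ q → (τ p ≟ i) ×-dec (τ q ≟ p) ×-dec (i ≺? q) ×-dec isPrev? p i) ×-dec (τ i ≺? i))

isPSB? : (τ : Fin n → Fin n) → Dec (IsPSB τ)
isPSB? {n} τ = isTour? τ ×-dec all? λ i →
  (peak? τ i ×-dec ¬? (stepBackPeak? τ i)) →-dec (ℕ.suc (toℕ i) ℕ.≟ n)

sameTour? : (τ σ : Fin n → Fin n) → Dec (SameTour τ σ)
sameTour? τ σ = all? λ i → τ i ≟ σ i

module _ (τ≗σ : SameTour τ σ) where

  iter-resp : ∀ k i → iter τ k i ≡ iter σ k i
  iter-resp ℕ.zero    i = refl
  iter-resp (ℕ.suc k) i = trans (τ≗σ _) (cong σ (iter-resp k i))

  enteredFromBelow-resp : ∀ {i} → ∃ (λ p → τ p ≡ i × p ≺ i) → ∃ (λ p → σ p ≡ i × p ≺ i)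
  enteredFromBelow-resp (p , τp≡i , p≺i) = p , trans (sym (τ≗σ p)) τp≡i , p≺i

  peak-resp : ∀ {i} → Peak τ i → Peak σ i
  peak-resp {i} (below , τi≺i) = enteredFromBelow-resp below , subst (_≺ i) (τ≗σ i) τi≺i

  stepBackPeak-resp : ∀ {i} → StepBackPeak τ i → StepBackPeak σ i
  stepBackPeak-resp {i} (inj₁ (below , prev , i≺ττi)) =
    inj₁ (enteredFromBelow-resp below , subst (λ j → IsPrev j i) (τ≗σ i) prev ,
          subst (i ≺_) (trans (τ≗σ (τ i)) (cong σ (τ≗σ i))) i≺ττi)
  stepBackPeak-resp {i} (inj₂ ((p , q , τp≡i , τq≡p , i≺q , prev) , τi≺i)) =
    inj₂ ((p , q , trans (sym (τ≗σ p)) τp≡i , trans (sym (τ≗σ q)) τq≡p , i≺q , prev) ,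
          subst (_≺ i) (τ≗σ i) τi≺i)

  isTour-resp : IsTour τ → IsTour σ
  isTour-resp (loopless , connected) =
      (λ i σi≡i → loopless i (trans (τ≗σ i) σi≡i))
    , (λ i j → let k , reach = connected i j in k , trans (sym (iter-resp k i)) reach)

isPSB-resp : SameTour τ σ → IsPSB τ → IsPSB σ
isPSB-resp τ≗σ (tour , onlyPeak) =
  isTour-resp τ≗σ tour ,
  λ i (peak , ¬stepBack) → onlyPeak i (peak-resp (sym ∘ τ≗σ) peak , ¬stepBack ∘ stepBackPeak-resp τ≗σ)

module _ (x y : Fin n → Fin n) where

  -- A tour inside x ∪ y is determined by the set of cities where it follows x.
  choose : Subset n → Fin n → Fin n
  choose s i = if lookup s i then x i else y i

  choose-edgesIn : ∀ s → EdgesIn (choose s) x y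
  choose-edgesIn s i with lookup s i
  ... | true  = inj₁ refl
  ... | false = inj₂ refl

  agreement : (Fin n → Fin n) → Subset n
  agreement z = tabulate λ i → does (z i ≟ x i)

  edgesIn⇒choose : ∀ {z} → EdgesIn z x y → SameTour z (choose (agreement z))
  edgesIn⇒choose {z} inUnion i rewrite lookup∘tabulate (λ i → does (z i ≟ x i)) i
    with z i ≟ x i | inUnion i
  ... | yes zi≡xi | _          = zi≡xi
  ... | no zi≢xi  | inj₁ zi≡xi = ⊥-elim (zi≢xi zi≡xi)
  ... | no _      | inj₂ zi≡yi = zi≡yi

  search-union : {R : (Fin n → Fin n) → Set} → Decidable R → (∀ {z w} → SameTour z w → R z → R w) →
                 Dec (∃ λ z → EdgesIn z x y × R z)
  search-union R? R-resp =
    map′ (λ (s , r) → choose s , choose-edgesIn s , r)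
         (λ (z , inUnion , r) → agreement z , R-resp (edgesIn⇒choose inUnion) r)
         (anySubset? (R? ∘ choose))

differing-city : ¬ SameTour τ σ → ∃ λ i → ¬ τ i ≡ σ i
differing-city {τ = τ} {σ} = ¬∀⟶∃¬ _ _ (λ i → τ i ≟ σ i)

¬SameTour-resp : ∀ {ρ : Fin n → Fin n} → SameTour τ σ → ¬ SameTour τ ρ → ¬ SameTour σ ρ
¬SameTour-resp τ≗σ τ≢ρ σ≗ρ = τ≢ρ (λ i → trans (τ≗σ i) (σ≗ρ i))

EdgesIn-≢ : ∀ {x y z : Fin n → Fin n} {i} → EdgesIn z x y → ¬ z i ≡ x i → z i ≡ y i
EdgesIn-≢ {i = i} inUnion zi≢xi with inUnion i
... | inj₁ zi≡xi = ⊥-elim (zi≢xi zi≡xi)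
... | inj₂ zi≡yi = zi≡yi

-- Adjacent x y unfolds to AdjacentIn IsPSB x y.
AdjacentIn : ((Fin n → Fin n) → Set) → (Fin n → Fin n) → (Fin n → Fin n) → Set
AdjacentIn {n} P x y =
  ¬ SameTour x y ×
  ∃ λ (c : Fin n → Fin n → ℚ) →
    value c x ≡ value c y ×
    (∀ z → P z → ¬ SameTour z x → ¬ SameTour z y → value c z ℚ.< value c x)

adjacent-by-minimum : ∀ {P : (Fin n → Fin n) → Set} {x y} (d : Fin n → Fin n → ℚ) →
  ¬ SameTour x y → value d x ≡ value d y →
  (∀ z → P z → ¬ SameTour z x → ¬ SameTour z y → value d x ℚ.< value d z) →
  AdjacentIn P x y
adjacent-by-minimum {x = x} {y} d x≢y dx≡dy dx<dz =
  x≢y , (λ i j → - d i j) ,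
  trans (value-neg d x) (trans (cong -_ dx≡dy) (sym (value-neg d y))) ,
  λ z pz z≢x z≢y → subst₂ ℚ._<_ (sym (value-neg d z)) (sym (value-neg d x))
                     (ℚ.neg-antimono-< (dx<dz z pz z≢x z≢y))

module Penalty (x y : Fin n → Fin n) where

  InUnion : Fin n → Fin n → Set
  InUnion i j = j ≡ x i ⊎ j ≡ y i

  Penalised : (u v i j : Fin n) → Set
  Penalised u v i j = ¬ InUnion i j ⊎ (i ≡ u × j ≡ v)

  inUnion? : ∀ i j → Dec (InUnion i j)
  inUnion? i j = (j ≟ x i) ⊎-dec (j ≟ y i)

  penalised? : ∀ u v i j → Dec (Penalised u v i j)
  penalised? u v i j = ¬? (inUnion? i j) ⊎-dec ((i ≟ u) ×-dec (j ≟ v))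

  penalty : (u v : Fin n) (z : Fin n → Fin n) → ℚ
  penalty u v z = count λ i → penalised? u v i (z i)

  penalty-≡0 : ∀ {u v z} → EdgesIn z x y → ¬ z u ≡ v → penalty u v z ≡ 0ℚ
  penalty-≡0 {u} {v} {z} inUnion zu≢v = count-≡0 (λ i → penalised? u v i (z i)) λ where
    i (inj₁ outside)       → outside (inUnion i)
    i (inj₂ (refl , zu≡v)) → zu≢v zu≡v

  penalty-≡1 : ∀ {u v z} → EdgesIn z x y → z u ≡ v → penalty u v z ≡ 1ℚ
  penalty-≡1 {u} {v} {z} inUnion zu≡v =
    count-≡1 (λ i → penalised? u v i (z i)) (inj₂ (refl , zu≡v)) λ where
      i (inj₁ outside)    → ⊥-elim (outside (inUnion i))
      i (inj₂ (i≡u , _)) → i≡u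

  penalty-≥1 : ∀ {u v} z i → Penalised u v i (z i) → 1ℚ ℚ.≤ penalty u v z
  penalty-≥1 {u} {v} z i = count-≥1 (λ i → penalised? u v i (z i))

module Deficit (x y : Fin n → Fin n) (a b : Fin n) where
  open Penalty x y

  deficit : Fin n → Fin n → ℚ
  deficit i j = 𝟙 (penalised? a (y a) i j) ℚ.+ 𝟙 (penalised? b (x b) i j)

  value-deficit : ∀ z → value deficit z ≡ penalty a (y a) z ℚ.+ penalty b (x b) z
  value-deficit z = trans (value≡sum deficit z)
    (∑-distrib-+ (λ i → 𝟙 (penalised? a (y a) i (z i))) (λ i → 𝟙 (penalised? b (x b) i (z i))))

  value-deficit-≥2 : ∀ z i j → Penalised a (y a) i (z i) → Penalised b (x b) j (z j) →
                     1ℚ ℚ.+ 1ℚ ℚ.≤ value deficit z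
  value-deficit-≥2 z i j pᵢ pⱼ =
    subst (1ℚ ℚ.+ 1ℚ ℚ.≤_) (sym (value-deficit z)) (ℚ.+-mono-≤ (penalty-≥1 z i pᵢ) (penalty-≥1 z j pⱼ))

  value-deficit-x : ¬ x a ≡ y a → value deficit x ≡ 1ℚ
  value-deficit-x xa≢ya = trans (value-deficit x)
    (cong₂ ℚ._+_ (penalty-≡0 (λ _ → inj₁ refl) xa≢ya) (penalty-≡1 (λ _ → inj₁ refl) refl))

  value-deficit-y : ¬ x b ≡ y b → value deficit y ≡ 1ℚ
  value-deficit-y xb≢yb = trans (value-deficit y)
    (cong₂ ℚ._+_ (penalty-≡1 (λ _ → inj₂ refl) refl) (penalty-≡0 (λ _ → inj₂ refl) (xb≢yb ∘ sym)))

module _ {P : (Fin n → Fin n) → Set} (P? : Decidable P) (P-resp : ∀ {τ σ} → SameTour τ σ → P τ → P σ)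
         {x y : Fin n → Fin n} (x≢y : ¬ SameTour x y) where
  open Penalty x y

  Rival : (Fin n → Fin n) → Set
  Rival z = P z × ¬ SameTour z x × ¬ SameTour z y

  rival? : Decidable Rival
  rival? z = P? z ×-dec ¬? (sameTour? z x) ×-dec ¬? (sameTour? z y)

  rival-resp : ∀ {z w} → SameTour z w → Rival z → Rival w
  rival-resp z≗w (pz , z≢x , z≢y) = P-resp z≗w pz , ¬SameTour-resp z≗w z≢x , ¬SameTour-resp z≗w z≢y

  adjacent-by-deficit : ∀ {a b} → ¬ x a ≡ y a → ¬ x b ≡ y b →
    (∀ z → EdgesIn z x y → Rival z → 1ℚ ℚ.+ 1ℚ ℚ.≤ value (Deficit.deficit x y a b) z) →
    AdjacentIn P x y
  adjacent-by-deficit {a} {b} xa≢ya xb≢yb bound =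
    adjacent-by-minimum deficit x≢y (trans (value-deficit-x xa≢ya) (sym (value-deficit-y xb≢yb)))
      λ z pz z≢x z≢y → subst (ℚ._< value deficit z) (sym (value-deficit-x xa≢ya))
                         (ℚ.<-≤-trans 1<2 (deficit-≥2 z (pz , z≢x , z≢y)))
    where
    open Deficit x y a b
    1<2 : 1ℚ ℚ.< 1ℚ ℚ.+ 1ℚ
    1<2 = toWitness {a? = 1ℚ ℚ.<? 1ℚ ℚ.+ 1ℚ} _
    deficit-≥2 : ∀ z → Rival z → 1ℚ ℚ.+ 1ℚ ℚ.≤ value deficit z
    deficit-≥2 z rival with all? (λ i → inUnion? i (z i))
    ... | yes inUnion = bound z inUnion rival
    ... | no leaves   = let i , outside = ¬∀⟶∃¬ _ _ (λ i → inUnion? i (z i)) leaves in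
                        value-deficit-≥2 z i i (inj₁ outside) (inj₁ outside)

  adjacent-if-no-rival : ¬ (∃ λ z → EdgesIn z x y × Rival z) → AdjacentIn P x y
  adjacent-if-no-rival none =
    let _ , xa≢ya = differing-city x≢y in
    adjacent-by-deficit xa≢ya xa≢ya λ z inUnion rival → ⊥-elim (none (z , inUnion , rival))

  adjacent-if-unique-rival : ∀ {z₁ a b} → EdgesIn z₁ x y → ¬ z₁ a ≡ x a → ¬ z₁ b ≡ y b →
    (∀ z → EdgesIn z x y → Rival z → SameTour z z₁) → AdjacentIn P x y
  adjacent-if-unique-rival {z₁} {a} {b} inUnion₁ z₁a≢xa z₁b≢yb unique =
    adjacent-by-deficit xa≢ya xb≢yb λ z inUnion rival →
      let z≗z₁ = unique z inUnion rival in
      Deficit.value-deficit-≥2 x y a b z a b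
        (inj₂ (refl , trans (z≗z₁ a) z₁a≡ya)) (inj₂ (refl , trans (z≗z₁ b) z₁b≡xb))
    where
    z₁a≡ya : z₁ a ≡ y a
    z₁a≡ya = EdgesIn-≢ inUnion₁ z₁a≢xa
    z₁b≡xb : z₁ b ≡ x b
    z₁b≡xb = EdgesIn-≢ (swap ∘ inUnion₁) z₁b≢yb
    xa≢ya : ¬ x a ≡ y a
    xa≢ya xa≡ya = z₁a≢xa (trans z₁a≡ya (sym xa≡ya))
    xb≢yb : ¬ x b ≡ y b
    xb≢yb xb≡yb = z₁b≢yb (trans z₁b≡xb xb≡yb)

  nonadjacent⇒two-rivals : ¬ AdjacentIn P x y →
    ∃₂ λ z₁ z₂ → (EdgesIn z₁ x y × Rival z₁) × (EdgesIn z₂ x y × Rival z₂) × ¬ SameTour z₁ z₂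
  nonadjacent⇒two-rivals nonadjacent with search-union x y rival? rival-resp
  ... | no none = ⊥-elim (nonadjacent (adjacent-if-no-rival none))
  ... | yes (z₁ , inUnion₁ , rival₁@(_ , z₁≢x , z₁≢y))
    with search-union x y (λ z → rival? z ×-dec ¬? (sameTour? z z₁))
                          (λ z≗w (rival , z≢z₁) → rival-resp z≗w rival , ¬SameTour-resp z≗w z≢z₁)
  ...   | yes (z₂ , inUnion₂ , rival₂ , z₂≢z₁) =
    z₁ , z₂ , (inUnion₁ , rival₁) , (inUnion₂ , rival₂) , λ z₁≗z₂ → z₂≢z₁ (sym ∘ z₁≗z₂)
  ...   | no noSecond = ⊥-elim (nonadjacent (adjacent-if-unique-rival inUnion₁
            (proj₂ (differing-city z₁≢x)) (proj₂ (differing-city z₁≢y))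
            λ z inUnion rival → decidable-stable (sameTour? z z₁)
                                  λ z≢z₁ → noSecond (z , inUnion , rival , z≢z₁)))

lemma2 : (n : ℕ) (x y : Fin n → Fin n) → IsPSB x → IsPSB y → ¬ SameTour x y → ¬ Adjacent x y → ∃ λ z₁ → ∃ λ z₂ → IsPSB z₁ × IsPSB z₂ × ¬ SameTour z₁ z₂ × ¬ SameTour z₁ x × ¬ SameTour z₁ y × ¬ SameTour z₂ x × ¬ SameTour z₂ y × EdgesIn z₁ x y × EdgesIn z₂ x y
lemma2 n x y _ _ x≢y nonadjacent =
  let z₁ , z₂ , (inUnion₁ , psb₁ , z₁≢x , z₁≢y) , (inUnion₂ , psb₂ , z₂≢x , z₂≢y) , z₁≢z₂ =
        nonadjacent⇒two-rivals isPSB? isPSB-resp x≢y nonadjacent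
  in z₁ , z₂ , psb₁ , psb₂ , z₁≢z₂ , z₁≢x , z₁≢y , z₂≢x , z₂≢y , inUnion₁ , inUnion₂
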